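{- Let $k\geq l\geq 1$ and let $\widetilde T_{k,l}$ be the set of families of positive integers $T=(a_i,b_i)_{1\leq i\leq k-l}$ such that $a_i\leq b_i\leq l+i-1$ for all $i$, and $a_i<b_{i+1}$ for $1\leq i<k-l$ (these are the column-strict reverse plane partitions of skew shape $(k-l+1,k-l,\ldots,2)/(k-l-1,k-l-2,\ldots,0)$ with positive entries, row $i$ having entries $a_i,b_i$ from left to right, with largest entry in row $i$ at most $l+i-1$). Put $|T|=\sum_{i=1}^{k-l}(a_i+b_i)$. Then $$d_{k,l}(q)=\sum_{T\in\widetilde T_{k,l}}q^{ -2(k-l)+|T|}.$$
   Context: For $m\in\mathbb Z$, $r\in\mathbb N$: $(x;q)_r=(1-x)(1-xq)\cdots(1-xq^{r-1})$ and ${m\brack r}_q=\frac{(q^{m-r+1};q)_r}{(q;q)_r}$. Let $H_q$ be the lower unitriangular matrix with $(H_q)_{i,j}={ -j\brack 2i-2j}_q\,q^{(i-j)(2i-1)}$ $(={2i-j-1\brack 2i-2j}_q)$ for $j\leq i$ and $0$ for $j>i$, and $H_q^{ -1}=((-1)^{i-j}d_{i,j}(q))_{i,j\geq 1}$. A column-strict reverse plane partition of a skew shape is a filling of its cells weakly increasing from left to right along rows and strictly increasing from top to bottom along (geometric) columns; in the shape above the left cell of row $i$ and the right cell of row $i+1$ lie in the same column. -}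

module Defs where

open import Level using (Level)
open import Algebra.Bundles using (CommutativeRing)
open import Data.Nat as ℕ using (ℕ; zero; suc; _∸_; _≤ᵇ_; _<ᵇ_)
open import Data.Bool using (Bool; true; false; _∧_; if_then_else_)
open import Data.Product using (_×_; _,_)
open import Data.List as List using (List; []; _∷_; _++_; upTo; zipWith; concatMap; filter; cartesianProduct)
open import Data.Vec as Vec using (Vec; []; _∷_)
open import Relation.Nullary.Decidable using (yes; no)
open import Data.Bool.Properties using (T?)

-- Everything is interpreted in an arbitrary commutative ring R at an arbitrary
-- element q.  (Identities valid in every commutative ring at every q are exactly
-- the identities in ℤ[q]; take R = ℤ[q], q = the variable.)
module WithRing {c ℓ : Level} (R : CommutativeRing c ℓ) (q : CommutativeRing.Carrier R) where
  open CommutativeRing R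

  pow : Carrier → ℕ → Carrier
  pow x zero = 1#
  pow x (suc n) = x * pow x n

  sumR : List Carrier → Carrier
  sumR [] = 0#
  sumR (x ∷ xs) = x + sumR xs

  -- Gaussian binomial [n brack r]_q for n ≥ 0, via the q-Pascal rule
  -- [n+1, r+1] = [n, r] + q^(r+1) [n, r+1]; this is the polynomial equal to
  -- (q^(n-r+1);q)_r / (q;q)_r.
  qbinom : ℕ → ℕ → Carrier
  qbinom n zero = 1#
  qbinom zero (suc r) = 0#
  qbinom (suc n) (suc r) = qbinom n r + pow q (suc r) * qbinom n (suc r)

  H : ℕ → ℕ → Carrier
  H i j = if j ≤ᵇ i then qbinom (2 ℕ.* i ∸ j ∸ 1) (2 ℕ.* i ∸ 2 ℕ.* j) else 0#

  -- Column j of H_q^{-1} by forward substitution (H is lower unitriangular):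
  -- invCol j n = [x_0, …, x_n] with x_t = (H_q^{-1})_{j+t, j}, where
  -- x_0 = 1 and x_{n} = - Σ_{t<n} H_{j+n, j+t} x_t.
  invCol : ℕ → ℕ → List Carrier
  invCol j zero = 1# ∷ []
  invCol j (suc n) =
    let xs = invCol j n in
    xs ++ (- sumR (zipWith (λ t x → H (j ℕ.+ suc n) (j ℕ.+ t) * x) (upTo (suc n)) xs)) ∷ []

  lastOr : Carrier → List Carrier → Carrier
  lastOr d [] = d
  lastOr d (x ∷ xs) = lastOr x xs

  Hinv : ℕ → ℕ → Carrier
  Hinv i j = if j ≤ᵇ i then lastOr 0# (invCol j (i ∸ j)) else 0#

  d : ℕ → ℕ → Carrier
  d i j = pow (- 1#) (i ∸ j) * Hinv i j

  -- Families T = (a_i, b_i)_{1 ≤ i ≤ n} stored as a vector (row i at position i-1).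
  -- validFrom c T: row r (0-based) satisfies 1 ≤ a ≤ b ≤ c + r, and a_i < b_{i+1}.
  linked : ∀ {n} → ℕ → Vec (ℕ × ℕ) n → Bool
  linked a [] = true
  linked a ((a' , b') ∷ _) = a <ᵇ b'

  validFrom : ∀ {n} → ℕ → Vec (ℕ × ℕ) n → Bool
  validFrom c [] = true
  validFrom c ((a , b) ∷ rest) =
    (1 ≤ᵇ a) ∧ (a ≤ᵇ b) ∧ (b ≤ᵇ c) ∧ linked a rest ∧ validFrom (suc c) rest

  InT̃ : (l : ℕ) → ∀ {n} → Vec (ℕ × ℕ) n → Bool
  InT̃ l T = validFrom l T

  allVecs : ∀ {a} {A : Set a} (n : ℕ) → List A → List (Vec A n)
  allVecs zero xs = [] ∷ []
  allVecs (suc n) xs = concatMap (λ x → List.map (x ∷_) (allVecs n xs)) xs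

  -- T̃_{k,l} as an explicit finite list: all candidate families with entries in
  -- {0,…,k} (every member of T̃_{k,l} has entries ≤ l+(k-l)-1 < k) filtered by InT̃.
  T̃ : (k l : ℕ) → List (Vec (ℕ × ℕ) (k ∸ l))
  T̃ k l = filter (λ T → T? (InT̃ l T))
              (allVecs (k ∸ l) (cartesianProduct (upTo (suc k)) (upTo (suc k))))

  size : ∀ {n} → Vec (ℕ × ℕ) n → ℕ
  size [] = 0
  size ((a , b) ∷ rest) = a ℕ.+ b ℕ.+ size rest

  -- Σ_{T ∈ T̃_{k,l}} q^{-2(k-l)+|T|}   (exponent is ≥ 0 since all entries ≥ 1)
  rhs : ℕ → ℕ → Carrier
  rhs k l = sumR (List.map (λ T → pow q (size T ∸ 2 ℕ.* (k ∸ l))) (T̃ k l))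

{-# OPTIONS --safe #-}
-- Write h_r(m) for the complete homogeneous symmetric polynomial
-- h_r(1, q, …, q^(m-1)); the q-Pascal rule gives (H_q)_{i,j} = h_{2(i-j)}(j).
-- Let Φ_c(n, a) be the generating function of the families of n rows whose
-- first row (a', b) has a < b ≤ c, the bound growing by one per row; it obeys
-- a transfer recursion over its first row.  Splitting h_{s+2}(m) according to
-- its two largest variables gives
--   h_{s+2}(m) = h_{s+2}(min(a,m)) + Σ_{a<b≤m, 1≤a'≤b} q^(a'-1) q^(b-1) h_s(a'),
-- which is exactly what the induction on r in
--   Σ_{t≤r} h_{2(r-t)}(m+t) (-1)^t Φ_m(t, a) = h_{2r}(min(a,m))
-- needs.  At a = 0 the right-hand side vanishes for r > 0, so
-- ((-1)^t Φ_l(t, 0))_t is the l-th column of H_q^{-1}, i.e. d_{l+n,l} = Φ_l(n, 0);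
-- and T̃_{k,l} enumerates exactly the families counted by Φ_l(k-l, 0).
module Submission where

open import Defs
open import Level using (Level)
open import Algebra.Bundles using (CommutativeRing; CommutativeSemiring)
import Algebra.Properties.CommutativeSemigroup as CommutativeSemigroupProperties
import Algebra.Properties.Ring as RingProperties
open import Data.Bool using (Bool; true; false; T; _∧_; if_then_else_)
open import Data.Bool.Properties using (∧-assoc; ∧-zeroʳ; T-≡; T-∧; T?)
open import Data.List as List using (List; []; _∷_; _++_; upTo; zipWith; concatMap; cartesianProduct)
import Data.List.Properties as List
open import Data.List.Relation.Binary.Pointwise as Pointwise using (Pointwise; []; _∷_)
open import Data.Nat as ℕ using (ℕ; zero; suc; _≤_; _<_; _∸_; _⊓_; _≤ᵇ_; _<ᵇ_; z≤n; s≤s)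
import Data.Nat.Properties as ℕₚ
open import Data.Nat.Tactic.RingSolver using (solve-∀)
open import Data.Product using (_×_; _,_; proj₂)
open import Data.Sum using (inj₁; inj₂)
open import Data.Vec using (Vec; []; _∷_)
open import Function using (_∘′_)
open import Function.Bundles using (module Equivalence)
open import Relation.Binary.PropositionalEquality as Eq using (_≡_)
open import Relation.Nullary using (yes; no; contradiction)
open import Relation.Nullary.Reflects using (ofʸ)

≤ᵇ-true : ∀ {m n} → m ≤ n → (m ≤ᵇ n) ≡ true
≤ᵇ-true m≤n = Equivalence.to T-≡ (ℕₚ.≤⇒≤ᵇ m≤n)

<ᵇ-true : ∀ {m n} → m < n → (m <ᵇ n) ≡ true
<ᵇ-true m<n = Equivalence.to T-≡ (ℕₚ.<⇒<ᵇ m<n)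

≤ᵇ-false : ∀ {m n} → n < m → (m ≤ᵇ n) ≡ false
≤ᵇ-false {m} {n} n<m with m ≤ᵇ n | ℕₚ.≤ᵇ-reflects-≤ m n
... | false | _        = Eq.refl
... | true  | ofʸ m≤n = contradiction m≤n (ℕₚ.<⇒≱ n<m)

<ᵇ-false : ∀ {m n} → n ≤ m → (m <ᵇ n) ≡ false
<ᵇ-false {m} {n} n≤m with m <ᵇ n | ℕₚ.<ᵇ-reflects-< m n
... | false | _        = Eq.refl
... | true  | ofʸ m<n = contradiction m<n (ℕₚ.≤⇒≯ n≤m)

T-∧ʳ : ∀ {x y} → T (x ∧ y) → T y
T-∧ʳ = proj₂ ∘′ Equivalence.to T-∧

map-upTo-suc : ∀ {a} {A : Set a} (f : ℕ → A) n → List.map f (upTo (suc n)) ≡ List.map f (upTo n) ++ f n ∷ []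
map-upTo-suc f n = Eq.trans (Eq.cong (List.map f) (Eq.sym (List.upTo-∷ʳ n))) (List.map-++ f (upTo n) (n ∷ []))

module RangeSum {c ℓ} (S : CommutativeSemiring c ℓ) where
  open CommutativeSemiring S
  open import Relation.Binary.Reasoning.Setoid setoid
  open CommutativeSemigroupProperties +-commutativeSemigroup using (interchange)

  ∑ : ℕ → (ℕ → Carrier) → Carrier
  ∑ zero    f = 0#
  ∑ (suc n) f = ∑ n f + f n

  syntax ∑ n (λ i → e) = ∑[ i < n ] e

  ∑-cong< : ∀ n {f g} → (∀ i → i < n → f i ≈ g i) → ∑ n f ≈ ∑ n g
  ∑-cong< zero    f≈g = refl
  ∑-cong< (suc n) f≈g = +-cong (∑-cong< n (λ i i<n → f≈g i (ℕₚ.m<n⇒m<1+n i<n))) (f≈g n ℕₚ.≤-refl)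

  ∑-cong : ∀ n {f g} → (∀ i → f i ≈ g i) → ∑ n f ≈ ∑ n g
  ∑-cong n f≈g = ∑-cong< n (λ i _ → f≈g i)

  ∑-zero : ∀ n {f} → (∀ i → i < n → f i ≈ 0#) → ∑ n f ≈ 0#
  ∑-zero zero    f≈0 = refl
  ∑-zero (suc n) f≈0 =
    trans (+-cong (∑-zero n (λ i i<n → f≈0 i (ℕₚ.m<n⇒m<1+n i<n))) (f≈0 n ℕₚ.≤-refl)) (+-identityʳ 0#)

  ∑-front : ∀ n f → ∑ (suc n) f ≈ f 0 + ∑ n (λ i → f (suc i))
  ∑-front zero    f = +-comm 0# (f 0)
  ∑-front (suc n) f = trans (+-congʳ (∑-front n f)) (+-assoc _ _ _)

  ∑-distrib-+ : ∀ n f g → ∑[ i < n ] (f i + g i) ≈ ∑ n f + ∑ n g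
  ∑-distrib-+ zero    f g = sym (+-identityʳ 0#)
  ∑-distrib-+ (suc n) f g = trans (+-congʳ (∑-distrib-+ n f g)) (interchange _ _ _ _)

  *-distribˡ-∑ : ∀ n x f → x * ∑ n f ≈ ∑[ i < n ] (x * f i)
  *-distribˡ-∑ zero    x f = zeroʳ x
  *-distribˡ-∑ (suc n) x f = trans (distribˡ x _ _) (+-congʳ (*-distribˡ-∑ n x f))

  ∑-comm : ∀ n m (f : ℕ → ℕ → Carrier) → ∑[ i < n ] ∑ m (f i) ≈ ∑[ j < m ] ∑[ i < n ] f i j
  ∑-comm zero    m f = sym (∑-zero m (λ _ _ → refl))
  ∑-comm (suc n) m f = trans (+-congʳ (∑-comm n m f)) (sym (∑-distrib-+ m _ _))

  ∑-truncate : ∀ {k} n f → k ≤ n → (∀ i → k ≤ i → f i ≈ 0#) → ∑ n f ≈ ∑ k f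
  ∑-truncate zero    f z≤n f≈0 = refl
  ∑-truncate (suc n) f k≤1+n f≈0 with ℕₚ.m≤n⇒m<n∨m≡n k≤1+n
  ... | inj₂ Eq.refl = refl
  ... | inj₁ k<1+n   = trans (+-cong (∑-truncate n f k≤n f≈0) (f≈0 n k≤n)) (+-identityʳ _)
    where k≤n = ℕₚ.≤-pred k<1+n

module _ {c ℓ : Level} (R : CommutativeRing c ℓ) (q : CommutativeRing.Carrier R) where
  open CommutativeRing R hiding (zero)
  open WithRing R q
  open RangeSum commutativeSemiring
  open RingProperties ring using (-1*x≈-x; -‿involutive; -‿+-comm; -0#≈0#; +-inverseʳ-unique)
  open CommutativeSemigroupProperties *-commutativeSemigroup using (x∙yz≈y∙xz; xy∙z≈y∙xz)
  open import Relation.Binary.Reasoning.Setoid setoid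
  open import Algebra.Solver.Ring.NaturalCoefficients.Default commutativeSemiring
    using (solve; _:=_; _:+_; _:*_)

  ∑-neg : ∀ n f → ∑[ i < n ] (- f i) ≈ - ∑ n f
  ∑-neg zero    f = sym -0#≈0#
  ∑-neg (suc n) f = trans (+-congʳ (∑-neg n f)) (-‿+-comm _ _)

  pow-+ : ∀ m n → pow q (m ℕ.+ n) ≈ pow q m * pow q n
  pow-+ zero    n = sym (*-identityˡ _)
  pow-+ (suc m) n = trans (*-congˡ (pow-+ m n)) (sym (*-assoc _ _ _))

  sgn : ℕ → Carrier
  sgn = pow (- 1#)

  sgn*sgn : ∀ n → sgn n * sgn n ≈ 1#
  sgn*sgn zero    = *-identityˡ 1#
  sgn*sgn (suc n) = begin
    (- 1# * sgn n) * (- 1# * sgn n)  ≈⟨ solve 2 (λ m s → (m :* s) :* (m :* s) := (m :* m) :* (s :* s)) refl (- 1#) (sgn n) ⟩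
    (- 1# * - 1#) * (sgn n * sgn n)  ≈⟨ *-cong (trans (-1*x≈-x (- 1#)) (-‿involutive 1#)) (sgn*sgn n) ⟩
    1# * 1#                          ≈⟨ *-identityˡ 1# ⟩
    1#                               ∎

  h : ℕ → ℕ → Carrier
  h zero    m       = 1#
  h (suc r) zero    = 0#
  h (suc r) (suc m) = h (suc r) m + pow q m * h r (suc m)

  h-pascal : ∀ m r → h (suc r) (suc m) ≈ h r (suc m) + pow q (suc r) * h (suc r) m
  h-pascal zero r = begin
    0# + 1# * h r 1          ≈⟨ trans (+-identityˡ _) (*-identityˡ _) ⟩
    h r 1                    ≈⟨ sym (+-identityʳ _) ⟩
    h r 1 + 0#               ≈⟨ +-congˡ (sym (zeroʳ _)) ⟩
    h r 1 + pow q (suc r) * 0# ∎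
  h-pascal (suc m) zero = begin
    h 1 (suc m) + pow q (suc m) * 1#       ≈⟨ +-cong (h-pascal m zero) (*-identityʳ _) ⟩
    (1# + (q * 1#) * h 1 m) + q * pow q m  ≈⟨ +-congʳ (+-congˡ (*-congʳ (*-identityʳ q))) ⟩
    (1# + q * h 1 m) + q * pow q m         ≈⟨ +-assoc 1# _ _ ⟩
    1# + (q * h 1 m + q * pow q m)         ≈⟨ +-congˡ (sym (distribˡ q _ _)) ⟩
    1# + q * (h 1 m + pow q m)             ≈⟨ +-congˡ (*-cong (sym (*-identityʳ q)) (+-congˡ (sym (*-identityʳ _)))) ⟩
    1# + (q * 1#) * (h 1 m + pow q m * 1#) ∎
  h-pascal (suc m) (suc r) = begin
    h (2+r) (suc m) + pow q (suc m) * h (suc r) (2+m)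
      ≈⟨ +-cong (h-pascal m (suc r)) (*-congˡ (h-pascal (suc m) r)) ⟩
    (h (suc r) (suc m) + pow q (2+r) * h (2+r) m) + pow q (suc m) * (h r (2+m) + pow q (suc r) * h (suc r) (suc m))
      ≈⟨ solve 6 (λ a b c q pr pm → (a :+ (q :* (q :* pr)) :* b) :+ (q :* pm) :* (c :+ (q :* pr) :* a)
                                := (a :+ (q :* pm) :* c) :+ (q :* (q :* pr)) :* (b :+ pm :* a))
                 refl (h (suc r) (suc m)) (h (2+r) m) (h r (2+m)) q (pow q r) (pow q m) ⟩
    (h (suc r) (suc m) + pow q (suc m) * h r (2+m)) + pow q (2+r) * (h (2+r) m + pow q m * h (suc r) (suc m)) ∎
    where 2+r = suc (suc r)
          2+m = suc (suc m)

  qbinom-vanishes : ∀ {n r} → n < r → qbinom n r ≈ 0#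
  qbinom-vanishes {zero}  {suc r} _         = refl
  qbinom-vanishes {suc n} {suc r} (s≤s n<r) =
    trans (+-cong (qbinom-vanishes n<r) (trans (*-congˡ (qbinom-vanishes (ℕₚ.m<n⇒m<1+n n<r))) (zeroʳ _)))
          (+-identityʳ 0#)

  h≈qbinom : ∀ r p → h r (suc p) ≈ qbinom (p ℕ.+ r) r
  h≈qbinom zero    p = refl
  h≈qbinom (suc r) p = begin
    h (suc r) (suc p)                                           ≈⟨ h-pascal p r ⟩
    h r (suc p) + pow q (suc r) * h (suc r) p                   ≈⟨ +-cong (h≈qbinom r p) (*-congˡ (lower p)) ⟩
    qbinom (p ℕ.+ r) r + pow q (suc r) * qbinom (p ℕ.+ r) (suc r)
      ≡⟨ Eq.cong (λ n → qbinom n (suc r)) (Eq.sym (ℕₚ.+-suc p r)) ⟩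
    qbinom (p ℕ.+ suc r) (suc r)                                ∎
    where
    lower : ∀ p → h (suc r) p ≈ qbinom (p ℕ.+ r) (suc r)
    lower zero    = sym (qbinom-vanishes (ℕₚ.n<1+n r))
    lower (suc p) = trans (h≈qbinom (suc r) p) (reflexive (Eq.cong (λ n → qbinom n (suc r)) (ℕₚ.+-suc p r)))

  H-lower : ∀ {i j} → j ≤ i → H i j ≡ qbinom (2 ℕ.* i ∸ j ∸ 1) (2 ℕ.* i ∸ 2 ℕ.* j)
  H-lower {i} {j} j≤i =
    Eq.cong (λ b → if b then qbinom (2 ℕ.* i ∸ j ∸ 1) (2 ℕ.* i ∸ 2 ℕ.* j) else 0#) (≤ᵇ-true j≤i)

  H-diag : ∀ i → H i i ≈ 1#
  H-diag i = reflexive (Eq.trans (H-lower {i} ℕₚ.≤-refl) (Eq.cong (qbinom _) (ℕₚ.n∸n≡0 (2 ℕ.* i))))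

  H≈h : ∀ {i j} → 1 ≤ j → j ≤ i → H i j ≈ h (2 ℕ.* (i ∸ j)) j
  H≈h {j = suc p} (s≤s z≤n) j≤i with ℕₚ.m≤n⇒∃[o]m+o≡n j≤i
  ... | s , Eq.refl = begin
    H (suc p ℕ.+ s) (suc p)
      ≡⟨ H-lower j≤i ⟩
    qbinom (2 ℕ.* (suc p ℕ.+ s) ∸ suc p ∸ 1) (2 ℕ.* (suc p ℕ.+ s) ∸ 2 ℕ.* suc p)
      ≡⟨ Eq.cong₂ qbinom top bottom ⟩
    qbinom (p ℕ.+ 2 ℕ.* s) (2 ℕ.* s)
      ≈⟨ sym (h≈qbinom (2 ℕ.* s) p) ⟩
    h (2 ℕ.* s) (suc p)
      ≡⟨ Eq.cong (λ e → h (2 ℕ.* e) (suc p)) (Eq.sym (ℕₚ.m+n∸m≡n (suc p) s)) ⟩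
    h (2 ℕ.* (suc p ℕ.+ s ∸ suc p)) (suc p) ∎
    where
    top : 2 ℕ.* (suc p ℕ.+ s) ∸ suc p ∸ 1 ≡ p ℕ.+ 2 ℕ.* s
    top = Eq.cong (_∸ 1) (Eq.trans (Eq.cong (_∸ suc p) (double p s)) (ℕₚ.m+n∸m≡n (suc p) _))
      where double : ∀ p s → 2 ℕ.* (suc p ℕ.+ s) ≡ suc p ℕ.+ suc (p ℕ.+ 2 ℕ.* s)
            double = solve-∀
    bottom : 2 ℕ.* (suc p ℕ.+ s) ∸ 2 ℕ.* suc p ≡ 2 ℕ.* s
    bottom = Eq.trans (Eq.cong (_∸ 2 ℕ.* suc p) (ℕₚ.*-distribˡ-+ 2 (suc p) s))
                      (ℕₚ.m+n∸m≡n (2 ℕ.* suc p) (2 ℕ.* s))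

  when : Bool → Carrier → Carrier
  when b x = if b then x else 0#

  when-false : ∀ {b} x → b ≡ false → when b x ≈ 0#
  when-false x Eq.refl = refl

  when-cong : ∀ b {x y} → (T b → x ≈ y) → when b x ≈ when b y
  when-cong true  x≈y = x≈y _
  when-cong false _   = refl

  when-∧ : ∀ b₁ b₂ x y → when (b₁ ∧ b₂) (x * y) ≈ when b₁ x * when b₂ y
  when-∧ false _     x y = sym (zeroˡ _)
  when-∧ true  true  x y = refl
  when-∧ true  false x y = sym (zeroʳ _)

  w : ℕ → Carrier
  w e = pow q (e ∸ 1)

  -- w₊ agrees with w on positive entries but vanishes at 0, where w has the
  -- junk value 1.
  w₊ : ℕ → Carrier
  w₊ zero    = 0#
  w₊ (suc e) = pow q e

  -- a is the left entry of the previous row, and 0 for the first row.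
  rowOK : ℕ → ℕ → ℕ → Bool
  rowOK a a′ b = (a <ᵇ b) ∧ ((1 ≤ᵇ a′) ∧ (a′ ≤ᵇ b))

  rowWeight : ℕ → ℕ → ℕ → Carrier
  rowWeight a a′ b = when (rowOK a a′ b) (w a′ * w b)

  rowWeight-≤ : ∀ {a b} a′ → b ≤ a → rowWeight a a′ b ≈ 0#
  rowWeight-≤ {a} {b} a′ b≤a =
    when-false _ (Eq.cong (λ x → x ∧ ((1 ≤ᵇ a′) ∧ (a′ ≤ᵇ b))) (<ᵇ-false b≤a))

  rowWeight-< : ∀ a {a′ b} → b < a′ → rowWeight a a′ b ≈ 0#
  rowWeight-< a {a′} {b} b<a′ = when-false _ (Eq.trans
    (Eq.cong (λ x → (a <ᵇ b) ∧ ((1 ≤ᵇ a′) ∧ x)) (≤ᵇ-false b<a′))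
    (Eq.trans (Eq.cong ((a <ᵇ b) ∧_) (∧-zeroʳ (1 ≤ᵇ a′))) (∧-zeroʳ (a <ᵇ b))))

  rowWeight-last : ∀ {a m} a′ → a ≤ m → a′ ≤ suc m → rowWeight a a′ (suc m) ≈ w₊ a′ * pow q m
  rowWeight-last {a} {m} a′ a≤m a′≤1+m = begin
    rowWeight a a′ (suc m)                  ≡⟨ Eq.cong₂ (λ x y → when (x ∧ ((1 ≤ᵇ a′) ∧ y)) (w a′ * pow q m))
                                                         (<ᵇ-true (s≤s a≤m)) (≤ᵇ-true a′≤1+m) ⟩
    when ((1 ≤ᵇ a′) ∧ true) (w a′ * pow q m) ≈⟨ positive a′ ⟩
    w₊ a′ * pow q m                         ∎
    where
    positive : ∀ a′ → when ((1 ≤ᵇ a′) ∧ true) (w a′ * pow q m) ≈ w₊ a′ * pow q m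
    positive zero    = sym (zeroˡ _)
    positive (suc _) = refl

  h-suc : ∀ s m → h (suc s) m ≈ ∑[ a′ < suc m ] (w₊ a′ * h s a′)
  h-suc s zero    = sym (trans (+-identityˡ _) (zeroˡ _))
  h-suc s (suc m) = +-congʳ (h-suc s m)

  transfer : ℕ → ℕ → (ℕ → Carrier) → Carrier
  transfer m a g = ∑[ a′ < suc m ] ∑[ b < suc m ] (rowWeight a a′ b * g a′)

  transfer-cong : ∀ m a {g g′} → (∀ a′ → a′ ≤ m → g a′ ≈ g′ a′) → transfer m a g ≈ transfer m a g′
  transfer-cong m a g≈g′ =
    ∑-cong< (suc m) (λ a′ a′<1+m → ∑-cong (suc m) (λ _ → *-congˡ (g≈g′ a′ (ℕₚ.≤-pred a′<1+m))))

  *-distribˡ-transfer : ∀ m a x g → x * transfer m a g ≈ transfer m a (λ a′ → x * g a′)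
  *-distribˡ-transfer m a x g = trans (*-distribˡ-∑ (suc m) x _)
    (∑-cong (suc m) (λ a′ → trans (*-distribˡ-∑ (suc m) x _) (∑-cong (suc m) (λ b → x∙yz≈y∙xz x _ _))))

  ∑-transfer : ∀ n m a (g : ℕ → ℕ → Carrier) →
               ∑[ t < n ] transfer m a (g t) ≈ transfer m a (λ a′ → ∑[ t < n ] g t a′)
  ∑-transfer n m a g = begin
    ∑[ t < n ] ∑[ a′ < suc m ] ∑[ b < suc m ] (rowWeight a a′ b * g t a′)
      ≈⟨ ∑-comm n (suc m) _ ⟩
    ∑[ a′ < suc m ] ∑[ t < n ] ∑[ b < suc m ] (rowWeight a a′ b * g t a′)
      ≈⟨ ∑-cong (suc m) (λ a′ → ∑-comm n (suc m) _) ⟩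
    ∑[ a′ < suc m ] ∑[ b < suc m ] ∑[ t < n ] (rowWeight a a′ b * g t a′)
      ≈⟨ ∑-cong (suc m) (λ a′ → ∑-cong (suc m) (λ b → sym (*-distribˡ-∑ n _ _))) ⟩
    transfer m a (λ a′ → ∑[ t < n ] g t a′) ∎

  transfer-vanishes : ∀ {m a} g → m ≤ a → transfer m a g ≈ 0#
  transfer-vanishes {m} g m≤a = ∑-zero (suc m) (λ a′ _ → ∑-zero (suc m) (λ b b<1+m →
    trans (*-congʳ (rowWeight-≤ a′ (ℕₚ.≤-trans (ℕₚ.≤-pred b<1+m) m≤a))) (zeroˡ _)))

  -- Raising the bound m adds a row a′ = m + 1, which is empty, and a column
  -- b = m + 1, which is free of constraints once a ≤ m.
  transfer-suc : ∀ {a m} g → a ≤ m →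
                 transfer (suc m) a g ≈ transfer m a g + pow q m * ∑[ a′ < suc (suc m) ] (w₊ a′ * g a′)
  transfer-suc {a} {m} g a≤m = begin
    transfer (suc m) a g
      ≈⟨ ∑-distrib-+ (suc (suc m)) _ _ ⟩
    (transfer m a g + ∑[ b < suc m ] (rowWeight a (suc m) b * g (suc m)))
      + ∑[ a′ < suc (suc m) ] (rowWeight a a′ (suc m) * g a′)
      ≈⟨ +-cong (trans (+-congˡ emptyRow) (+-identityʳ _)) column ⟩
    transfer m a g + pow q m * ∑[ a′ < suc (suc m) ] (w₊ a′ * g a′) ∎
    where
    emptyRow : ∑[ b < suc m ] (rowWeight a (suc m) b * g (suc m)) ≈ 0#
    emptyRow = ∑-zero (suc m) (λ b b<1+m → trans (*-congʳ (rowWeight-< a b<1+m)) (zeroˡ _))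
    column : ∑[ a′ < suc (suc m) ] (rowWeight a a′ (suc m) * g a′)
           ≈ pow q m * ∑[ a′ < suc (suc m) ] (w₊ a′ * g a′)
    column = trans (∑-cong< (suc (suc m)) (λ a′ a′<2+m →
                      trans (*-congʳ (rowWeight-last a′ a≤m (ℕₚ.≤-pred a′<2+m))) (xy∙z≈y∙xz _ _ _)))
                   (sym (*-distribˡ-∑ (suc (suc m)) _ _))

  h-split-≤ : ∀ s {m a} → m ≤ a → h (suc (suc s)) m ≈ h (suc (suc s)) (a ⊓ m) + transfer m a (h s)
  h-split-≤ s m≤a = sym (trans (+-cong (reflexive (Eq.cong (h (suc (suc s))) (ℕₚ.m≥n⇒m⊓n≡n m≤a)))
                                       (transfer-vanishes (h s) m≤a))
                               (+-identityʳ _))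

  h-split : ∀ s m a → h (suc (suc s)) m ≈ h (suc (suc s)) (a ⊓ m) + transfer m a (h s)
  h-split s zero    a = h-split-≤ s {a = a} z≤n
  h-split s (suc m) a with a ℕₚ.≤? m
  ... | no  a≰m = h-split-≤ s (ℕₚ.≰⇒> a≰m)
  ... | yes a≤m = begin
    h (suc (suc s)) m + pow q m * h (suc s) (suc m)
      ≈⟨ +-congʳ (h-split s m a) ⟩
    (h (suc (suc s)) (a ⊓ m) + transfer m a (h s)) + pow q m * h (suc s) (suc m)
      ≈⟨ +-assoc _ _ _ ⟩
    h (suc (suc s)) (a ⊓ m) + (transfer m a (h s) + pow q m * h (suc s) (suc m))
      ≈⟨ +-cong (reflexive (Eq.cong (h (suc (suc s))) a⊓m≡a⊓1+m))
                (sym (trans (transfer-suc (h s) a≤m) (+-congˡ (*-congˡ (sym (h-suc s (suc m))))))) ⟩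
    h (suc (suc s)) (a ⊓ suc m) + transfer (suc m) a (h s) ∎
    where
    a⊓m≡a⊓1+m : a ⊓ m ≡ a ⊓ suc m
    a⊓m≡a⊓1+m = Eq.trans (ℕₚ.m≤n⇒m⊓n≡m a≤m) (Eq.sym (ℕₚ.m≤n⇒m⊓n≡m (ℕₚ.m≤n⇒m≤1+n a≤m)))

  Φ : ℕ → ℕ → ℕ → Carrier
  Φ c zero    a = 1#
  Φ c (suc n) a = transfer c a (Φ (suc c) n)

  alternatingSum : ℕ → ℕ → ℕ → Carrier
  alternatingSum m r a = ∑[ t < suc r ] (h (2 ℕ.* (r ∸ t)) (m ℕ.+ t) * (sgn t * Φ m t a))

  alternatingSum≈h : ∀ r m a → alternatingSum m r a ≈ h (2 ℕ.* r) (a ⊓ m)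
  alternatingSum≈h zero    m a = trans (+-identityˡ _) (trans (*-identityˡ _) (*-identityˡ _))
  alternatingSum≈h (suc r) m a = begin
    alternatingSum m (suc r) a
      ≈⟨ ∑-front (suc r) _ ⟩
    h (2 ℕ.* suc r) (m ℕ.+ 0) * (1# * 1#)
      + ∑[ t < suc r ] (h (2 ℕ.* (r ∸ t)) (m ℕ.+ suc t) * (sgn (suc t) * transfer m a (Φ (suc m) t)))
      ≈⟨ +-cong leading (∑-cong (suc r) later) ⟩
    h (suc (suc (2 ℕ.* r))) m + ∑[ t < suc r ] (- transfer m a (term t))
      ≈⟨ +-congˡ (trans (∑-neg (suc r) _) (-‿cong (∑-transfer (suc r) m a term))) ⟩
    h (suc (suc (2 ℕ.* r))) m - transfer m a (alternatingSum (suc m) r)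
      ≈⟨ +-congˡ (-‿cong (transfer-cong m a induction)) ⟩
    h (suc (suc (2 ℕ.* r))) m - transfer m a (h (2 ℕ.* r))
      ≈⟨ +-congʳ (h-split (2 ℕ.* r) m a) ⟩
    (h (suc (suc (2 ℕ.* r))) (a ⊓ m) + transfer m a (h (2 ℕ.* r))) - transfer m a (h (2 ℕ.* r))
      ≈⟨ trans (+-assoc _ _ _) (trans (+-congˡ (-‿inverseʳ _)) (+-identityʳ _)) ⟩
    h (suc (suc (2 ℕ.* r))) (a ⊓ m)
      ≡⟨ Eq.cong (λ e → h e (a ⊓ m)) 2+2r≡2[1+r] ⟩
    h (2 ℕ.* suc r) (a ⊓ m) ∎
    where
    2+2r≡2[1+r] : suc (suc (2 ℕ.* r)) ≡ 2 ℕ.* suc r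
    2+2r≡2[1+r] = Eq.sym (ℕₚ.*-suc 2 r)
    term : ℕ → ℕ → Carrier
    term t a′ = h (2 ℕ.* (r ∸ t)) (suc m ℕ.+ t) * (sgn t * Φ (suc m) t a′)
    leading : h (2 ℕ.* suc r) (m ℕ.+ 0) * (1# * 1#) ≈ h (suc (suc (2 ℕ.* r))) m
    leading = trans (*-congˡ (*-identityʳ 1#)) (trans (*-identityʳ _)
                (reflexive (Eq.cong₂ h (Eq.sym 2+2r≡2[1+r]) (ℕₚ.+-identityʳ m))))
    later : ∀ t → h (2 ℕ.* (r ∸ t)) (m ℕ.+ suc t) * (sgn (suc t) * transfer m a (Φ (suc m) t))
                ≈ - transfer m a (term t)
    later t = begin
      h′ * ((- 1# * sgn t) * transfer m a (Φ (suc m) t))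
        ≈⟨ solve 4 (λ x n s y → x :* ((n :* s) :* y) := n :* (x :* (s :* y))) refl h′ (- 1#) (sgn t) _ ⟩
      - 1# * (h′ * (sgn t * transfer m a (Φ (suc m) t)))
        ≈⟨ -1*x≈-x _ ⟩
      - (h′ * (sgn t * transfer m a (Φ (suc m) t)))
        ≈⟨ -‿cong (trans (*-congˡ (*-distribˡ-transfer m a (sgn t) _)) (*-distribˡ-transfer m a h′ _)) ⟩
      - transfer m a (λ a′ → h′ * (sgn t * Φ (suc m) t a′))
        ≡⟨ Eq.cong (λ e → - transfer m a (λ a′ → h (2 ℕ.* (r ∸ t)) e * (sgn t * Φ (suc m) t a′)))
                   (ℕₚ.+-suc m t) ⟩
      - transfer m a (term t) ∎
      where h′ = h (2 ℕ.* (r ∸ t)) (m ℕ.+ suc t)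
    induction : ∀ a′ → a′ ≤ m → alternatingSum (suc m) r a′ ≈ h (2 ℕ.* r) a′
    induction a′ a′≤m = trans (alternatingSum≈h r (suc m) a′)
                              (reflexive (Eq.cong (h (2 ℕ.* r)) (ℕₚ.m≤n⇒m⊓n≡m (ℕₚ.m≤n⇒m≤1+n a′≤m))))

  sumR-++ : ∀ xs ys → sumR (xs ++ ys) ≈ sumR xs + sumR ys
  sumR-++ []       ys = sym (+-identityˡ _)
  sumR-++ (x ∷ xs) ys = trans (+-congˡ (sumR-++ xs ys)) (sym (+-assoc _ _ _))

  sumR-cong : ∀ {A : Set} (xs : List A) {f g : A → Carrier} → (∀ x → f x ≈ g x) →
              sumR (List.map f xs) ≈ sumR (List.map g xs)
  sumR-cong []       f≈g = refl
  sumR-cong (x ∷ xs) f≈g = +-cong (f≈g x) (sumR-cong xs f≈g)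

  sumR-zero : ∀ {A : Set} (xs : List A) {f : A → Carrier} → (∀ x → f x ≈ 0#) → sumR (List.map f xs) ≈ 0#
  sumR-zero []       f≈0 = refl
  sumR-zero (x ∷ xs) f≈0 = trans (+-cong (f≈0 x) (sumR-zero xs f≈0)) (+-identityʳ 0#)

  *-distribˡ-sumR : ∀ {A : Set} x (f : A → Carrier) xs →
                    x * sumR (List.map f xs) ≈ sumR (List.map (λ y → x * f y) xs)
  *-distribˡ-sumR x f []       = zeroʳ x
  *-distribˡ-sumR x f (y ∷ ys) = trans (distribˡ x _ _) (+-congˡ (*-distribˡ-sumR x f ys))

  sumR-upTo : ∀ n f → sumR (List.map f (upTo n)) ≈ ∑ n f
  sumR-upTo zero    f = refl
  sumR-upTo (suc n) f = begin
    sumR (List.map f (upTo (suc n)))        ≡⟨ Eq.cong sumR (map-upTo-suc f n) ⟩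
    sumR (List.map f (upTo n) ++ f n ∷ [])  ≈⟨ sumR-++ (List.map f (upTo n)) (f n ∷ []) ⟩
    sumR (List.map f (upTo n)) + (f n + 0#) ≈⟨ +-cong (sumR-upTo n f) (+-identityʳ _) ⟩
    ∑ n f + f n                             ∎

  sumR-concatMap : ∀ {A B : Set} (g : A → List B) (f : B → Carrier) xs →
                   sumR (List.map f (concatMap g xs)) ≈ sumR (List.map (λ x → sumR (List.map f (g x))) xs)
  sumR-concatMap g f []       = refl
  sumR-concatMap g f (x ∷ xs) =
    trans (reflexive (Eq.cong sumR (List.map-++ f (g x) (concatMap g xs))))
          (trans (sumR-++ (List.map f (g x)) _) (+-congˡ (sumR-concatMap g f xs)))

  sumR-cartesianProduct : ∀ {A B : Set} (f : A × B → Carrier) xs ys →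
    sumR (List.map f (cartesianProduct xs ys)) ≈ sumR (List.map (λ x → sumR (List.map (λ y → f (x , y)) ys)) xs)
  sumR-cartesianProduct f []       ys = refl
  sumR-cartesianProduct f (x ∷ xs) ys =
    trans (reflexive (Eq.cong sumR (List.map-++ f (List.map (x ,_) ys) (cartesianProduct xs ys))))
          (trans (sumR-++ (List.map f (List.map (x ,_) ys)) _)
                 (+-cong (reflexive (Eq.cong sumR (Eq.sym (List.map-∘ {g = f} {f = x ,_} ys))))
                         (sumR-cartesianProduct f xs ys)))

  sumR-upTo² : ∀ n (f : ℕ × ℕ → Carrier) →
               sumR (List.map f (cartesianProduct (upTo n) (upTo n))) ≈ ∑[ i < n ] ∑[ j < n ] f (i , j)
  sumR-upTo² n f = trans (sumR-cartesianProduct f (upTo n) (upTo n))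
                         (trans (sumR-cong (upTo n) (λ i → sumR-upTo n _)) (sumR-upTo n _))

  sumR-allVecs : ∀ {A : Set} n (xs : List A) (f : Vec A (suc n) → Carrier) →
    sumR (List.map f (allVecs (suc n) xs)) ≈ sumR (List.map (λ x → sumR (List.map (λ v → f (x ∷ v)) (allVecs n xs))) xs)
  sumR-allVecs n xs f = trans (sumR-concatMap _ f xs)
    (sumR-cong xs (λ x → reflexive (Eq.cong sumR (Eq.sym (List.map-∘ {g = f} {f = x ∷_} (allVecs n xs))))))

  sumR-filter : ∀ {A : Set} (P : A → Bool) (f : A → Carrier) xs →
    sumR (List.map f (List.filter (λ x → T? (P x)) xs)) ≈ sumR (List.map (λ x → when (P x) (f x)) xs)
  sumR-filter P f []       = refl
  sumR-filter P f (x ∷ xs) with P x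
  ... | true  = +-congˡ (sumR-filter P f xs)
  ... | false = trans (sumR-filter P f xs) (sym (+-identityˡ _))

  sumR-zipWith-* : ∀ (x X : ℕ → Carrier) is {ys} → Pointwise _≈_ ys (List.map X is) →
                   sumR (zipWith (λ t y → x t * y) is ys) ≈ sumR (List.map (λ t → x t * X t) is)
  sumR-zipWith-* x X []       []             = refl
  sumR-zipWith-* x X (i ∷ is) (y≈Xi ∷ ys≈Xs) = +-cong (*-congˡ y≈Xi) (sumR-zipWith-* x X is ys≈Xs)

  lastOr-cong : ∀ {x y xs ys} → x ≈ y → Pointwise _≈_ xs ys → lastOr x xs ≈ lastOr y ys
  lastOr-cong x≈y []           = x≈y
  lastOr-cong _   (x≈y ∷ xs≈ys) = lastOr-cong x≈y xs≈ys

  lastOr-∷ʳ : ∀ d xs y → lastOr d (xs ++ y ∷ []) ≡ y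
  lastOr-∷ʳ d []       y = Eq.refl
  lastOr-∷ʳ d (x ∷ xs) y = lastOr-∷ʳ x xs y

  invCol≋ : ∀ j (X : ℕ → Carrier) → X 0 ≈ 1# →
            (∀ n → ∑[ t < suc (suc n) ] (H (j ℕ.+ suc n) (j ℕ.+ t) * X t) ≈ 0#) →
            ∀ n → Pointwise _≈_ (invCol j n) (List.map X (upTo (suc n)))
  invCol≋ j X X0≈1 HX≈0 zero    = sym X0≈1 ∷ []
  invCol≋ j X X0≈1 HX≈0 (suc n) =
    Eq.subst (Pointwise _≈_ _) (Eq.sym (map-upTo-suc X (suc n))) (Pointwise.++⁺ previous (next ∷ []))
    where
    previous = invCol≋ j X X0≈1 HX≈0 n
    Hrow : ℕ → Carrier
    Hrow t = H (j ℕ.+ suc n) (j ℕ.+ t)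
    solved : ∑[ t < suc n ] (Hrow t * X t) + X (suc n) ≈ 0#
    solved = trans (+-congˡ (sym (trans (*-congʳ (H-diag (j ℕ.+ suc n))) (*-identityˡ _)))) (HX≈0 n)
    next : - sumR (zipWith (λ t y → Hrow t * y) (upTo (suc n)) (invCol j n)) ≈ X (suc n)
    next = begin
      - sumR (zipWith (λ t y → Hrow t * y) (upTo (suc n)) (invCol j n))
        ≈⟨ -‿cong (sumR-zipWith-* Hrow X (upTo (suc n)) previous) ⟩
      - sumR (List.map (λ t → Hrow t * X t) (upTo (suc n)))
        ≈⟨ -‿cong (sumR-upTo (suc n) _) ⟩
      - ∑[ t < suc n ] (Hrow t * X t)
        ≈⟨ sym (+-inverseʳ-unique _ _ solved) ⟩
      X (suc n) ∎

  Hinv-column : ∀ j (X : ℕ → Carrier) → X 0 ≈ 1# →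
                (∀ n → ∑[ t < suc (suc n) ] (H (j ℕ.+ suc n) (j ℕ.+ t) * X t) ≈ 0#) →
                ∀ n → Hinv (j ℕ.+ n) j ≈ X n
  Hinv-column j X X0≈1 HX≈0 n = begin
    Hinv (j ℕ.+ n) j
      ≡⟨ Eq.cong (λ b → if b then lastOr 0# (invCol j (j ℕ.+ n ∸ j)) else 0#) (≤ᵇ-true (ℕₚ.m≤m+n j n)) ⟩
    lastOr 0# (invCol j (j ℕ.+ n ∸ j))
      ≡⟨ Eq.cong (λ e → lastOr 0# (invCol j e)) (ℕₚ.m+n∸m≡n j n) ⟩
    lastOr 0# (invCol j n)
      ≈⟨ lastOr-cong refl (invCol≋ j X X0≈1 HX≈0 n) ⟩
    lastOr 0# (List.map X (upTo (suc n)))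
      ≡⟨ Eq.trans (Eq.cong (lastOr 0#) (map-upTo-suc X n)) (lastOr-∷ʳ 0# (List.map X (upTo n)) (X n)) ⟩
    X n ∎

  Φ-column : ∀ {l} → 1 ≤ l → ∀ n →
             ∑[ t < suc (suc n) ] (H (l ℕ.+ suc n) (l ℕ.+ t) * (sgn t * Φ l t 0)) ≈ 0#
  Φ-column {l} 1≤l n = trans (∑-cong< (suc (suc n)) entry) (alternatingSum≈h (suc n) l 0)
    where
    entry : ∀ t → t < suc (suc n) → H (l ℕ.+ suc n) (l ℕ.+ t) * (sgn t * Φ l t 0)
                                  ≈ h (2 ℕ.* (suc n ∸ t)) (l ℕ.+ t) * (sgn t * Φ l t 0)
    entry t t<2+n = *-congʳ (trans
      (H≈h (ℕₚ.≤-trans 1≤l (ℕₚ.m≤m+n l t)) (ℕₚ.+-monoʳ-≤ l (ℕₚ.≤-pred t<2+n)))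
      (reflexive (Eq.cong (λ e → h (2 ℕ.* e) (l ℕ.+ t)) (ℕₚ.[m+n]∸[m+o]≡n∸o l (suc n) t))))

  d≈Φ : ∀ {l} → 1 ≤ l → ∀ n → d (l ℕ.+ n) l ≈ Φ l n 0
  d≈Φ {l} 1≤l n = begin
    sgn (l ℕ.+ n ∸ l) * Hinv (l ℕ.+ n) l ≡⟨ Eq.cong (λ e → sgn e * Hinv (l ℕ.+ n) l) (ℕₚ.m+n∸m≡n l n) ⟩
    sgn n * Hinv (l ℕ.+ n) l             ≈⟨ *-congˡ (Hinv-column l X (*-identityˡ 1#) (Φ-column 1≤l) n) ⟩
    sgn n * (sgn n * Φ l n 0)            ≈⟨ trans (sym (*-assoc _ _ _)) (trans (*-congʳ (sgn*sgn n)) (*-identityˡ _)) ⟩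
    Φ l n 0                              ∎
    where
    X : ℕ → Carrier
    X t = sgn t * Φ l t 0

  admissible : ∀ {n} → ℕ → ℕ → Vec (ℕ × ℕ) n → Bool
  admissible c a rs = linked a rs ∧ validFrom c rs

  admissible-∷ : ∀ {n} c a a′ b (rs : Vec (ℕ × ℕ) n) →
                 admissible c a ((a′ , b) ∷ rs) ≡ rowOK a a′ b ∧ ((b ≤ᵇ c) ∧ admissible (suc c) a′ rs)
  admissible-∷ c a a′ b rs = Eq.trans (Eq.cong ((a <ᵇ b) ∧_) (Eq.sym (∧-assoc (1 ≤ᵇ a′) (a′ ≤ᵇ b) _)))
                                      (Eq.sym (∧-assoc (a <ᵇ b) _ _))

  admissible-0 : ∀ {n} c (rs : Vec (ℕ × ℕ) n) → admissible c 0 rs ≡ validFrom c rs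
  admissible-0 c []                        = Eq.refl
  admissible-0 c ((a′ , suc b) ∷ rs)       = Eq.refl
  admissible-0 c ((zero , zero) ∷ rs)      = Eq.refl
  admissible-0 c ((suc a′ , zero) ∷ rs)    = Eq.refl

  -- |T| - 2(k-l), computed entrywise so that no truncated subtraction remains.
  excess : ∀ {n} → Vec (ℕ × ℕ) n → ℕ
  excess []             = 0
  excess ((a , b) ∷ rs) = (a ∸ 1) ℕ.+ ((b ∸ 1) ℕ.+ excess rs)

  pow-excess-∷ : ∀ {n} a b (rs : Vec (ℕ × ℕ) n) → pow q (excess ((a , b) ∷ rs)) ≈ (w a * w b) * pow q (excess rs)
  pow-excess-∷ a b rs = trans (pow-+ (a ∸ 1) _) (trans (*-congˡ (pow-+ (b ∸ 1) (excess rs))) (sym (*-assoc _ _ _)))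

  validFrom-tail : ∀ {n c} a b (rs : Vec (ℕ × ℕ) n) → T (validFrom c ((a , b) ∷ rs)) → T (validFrom (suc c) rs)
  validFrom-tail {c = c} a b rs =
    T-∧ʳ {linked a rs} ∘′ T-∧ʳ {b ≤ᵇ c} ∘′ T-∧ʳ {a ≤ᵇ b} ∘′ T-∧ʳ {1 ≤ᵇ a}

  size-valid : ∀ {n} c (rs : Vec (ℕ × ℕ) n) → T (validFrom c rs) → size rs ≡ 2 ℕ.* n ℕ.+ excess rs
  size-valid c []                    _ = Eq.refl
  size-valid c ((zero  , b)    ∷ rs) ()
  size-valid c ((suc a , zero) ∷ rs) ()
  size-valid {suc n} c ((suc a , suc b) ∷ rs) valid =
    Eq.trans (Eq.cong (suc a ℕ.+ suc b ℕ.+_) (size-valid (suc c) rs (validFrom-tail (suc a) (suc b) rs valid)))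
             (regroup a b n (excess rs))
    where
    regroup : ∀ a b n e → suc a ℕ.+ suc b ℕ.+ (2 ℕ.* n ℕ.+ e) ≡ 2 ℕ.* suc n ℕ.+ (a ℕ.+ (b ℕ.+ e))
    regroup = solve-∀

  familyWeight : ∀ {n} → ℕ → ℕ → Vec (ℕ × ℕ) n → Carrier
  familyWeight c a rs = when (admissible c a rs) (pow q (excess rs))

  familyWeight-∷ : ∀ {n c b} a a′ (rs : Vec (ℕ × ℕ) n) → b ≤ c →
                   familyWeight c a ((a′ , b) ∷ rs) ≈ rowWeight a a′ b * familyWeight (suc c) a′ rs
  familyWeight-∷ {c = c} {b} a a′ rs b≤c = begin
    when (admissible c a ((a′ , b) ∷ rs)) (pow q (excess ((a′ , b) ∷ rs)))
      ≡⟨ Eq.cong (λ x → when x (pow q (excess ((a′ , b) ∷ rs))))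
                 (Eq.trans (admissible-∷ c a a′ b rs)
                           (Eq.cong (λ x → rowOK a a′ b ∧ (x ∧ admissible (suc c) a′ rs)) (≤ᵇ-true b≤c))) ⟩
    when (rowOK a a′ b ∧ admissible (suc c) a′ rs) (pow q (a′ ∸ 1 ℕ.+ (b ∸ 1 ℕ.+ excess rs)))
      ≈⟨ when-cong (rowOK a a′ b ∧ admissible (suc c) a′ rs) (λ _ → pow-excess-∷ a′ b rs) ⟩
    when (rowOK a a′ b ∧ admissible (suc c) a′ rs) ((w a′ * w b) * pow q (excess rs))
      ≈⟨ when-∧ _ _ _ _ ⟩
    rowWeight a a′ b * familyWeight (suc c) a′ rs ∎

  familyWeight-> : ∀ {n c b} a a′ (rs : Vec (ℕ × ℕ) n) → c < b → familyWeight c a ((a′ , b) ∷ rs) ≈ 0#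
  familyWeight-> {c = c} {b} a a′ rs c<b = when-false _
    (Eq.trans (admissible-∷ c a a′ b rs)
              (Eq.trans (Eq.cong (λ x → rowOK a a′ b ∧ (x ∧ admissible (suc c) a′ rs)) (≤ᵇ-false c<b))
                        (∧-zeroʳ (rowOK a a′ b))))

  entries : ℕ → List (ℕ × ℕ)
  entries K = cartesianProduct (upTo (suc K)) (upTo (suc K))

  Φ-enumerated : ℕ → ℕ → ℕ → ℕ → Carrier
  Φ-enumerated K c n a = sumR (List.map (familyWeight c a) (allVecs n (entries K)))

  Φ-enumerated≈Φ : ∀ K c n a → n ℕ.+ c ≤ suc K → Φ-enumerated K c n a ≈ Φ c n a
  Φ-enumerated≈Φ K c zero    a _ = +-identityʳ 1#
  Φ-enumerated≈Φ K c (suc n) a n+c≤K+1 = begin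
    Φ-enumerated K c (suc n) a
      ≈⟨ sumR-allVecs n (entries K) _ ⟩
    sumR (List.map (λ e → sumR (List.map (λ rs → familyWeight c a (e ∷ rs)) V)) (entries K))
      ≈⟨ sumR-upTo² (suc K) _ ⟩
    ∑[ a′ < suc K ] ∑[ b < suc K ] sumR (List.map (λ rs → familyWeight c a ((a′ , b) ∷ rs)) V)
      ≈⟨ ∑-cong (suc K) (λ a′ → ∑-truncate (suc K) _ 1+c≤1+K (λ b c<b →
           sumR-zero V (λ rs → familyWeight-> a a′ rs c<b))) ⟩
    ∑[ a′ < suc K ] ∑[ b < suc c ] sumR (List.map (λ rs → familyWeight c a ((a′ , b) ∷ rs)) V)
      ≈⟨ ∑-cong (suc K) (λ a′ → ∑-cong< (suc c) (λ b b<1+c →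
           trans (sumR-cong V (λ rs → familyWeight-∷ a a′ rs (ℕₚ.≤-pred b<1+c))) (sym (*-distribˡ-sumR _ _ V)))) ⟩
    ∑[ a′ < suc K ] ∑[ b < suc c ] (rowWeight a a′ b * Φ-enumerated K (suc c) n a′)
      ≈⟨ ∑-truncate (suc K) _ 1+c≤1+K (λ a′ c<a′ → ∑-zero (suc c) (λ b b<1+c →
           trans (*-congʳ (rowWeight-< a (ℕₚ.<-≤-trans b<1+c c<a′))) (zeroˡ _))) ⟩
    transfer c a (Φ-enumerated K (suc c) n)
      ≈⟨ transfer-cong c a (λ a′ _ → Φ-enumerated≈Φ K (suc c) n a′ n+1+c≤K+1) ⟩
    Φ c (suc n) a ∎
    where
    V = allVecs n (entries K)
    n+1+c≤K+1 : n ℕ.+ suc c ≤ suc K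
    n+1+c≤K+1 = ℕₚ.≤-trans (ℕₚ.≤-reflexive (ℕₚ.+-suc n c)) n+c≤K+1
    1+c≤1+K : suc c ≤ suc K
    1+c≤1+K = ℕₚ.≤-trans (s≤s (ℕₚ.m≤n+m c n)) n+c≤K+1

  rhs≈Φ : ∀ {k l} → l ≤ k → rhs k l ≈ Φ l (k ∸ l) 0
  rhs≈Φ {k} {l} l≤k = begin
    rhs k l
      ≈⟨ sumR-filter (InT̃ l) _ V ⟩
    sumR (List.map (λ rs → when (validFrom l rs) (pow q (size rs ∸ 2 ℕ.* (k ∸ l)))) V)
      ≈⟨ sumR-cong V weights-agree ⟩
    Φ-enumerated k l (k ∸ l) 0
      ≈⟨ Φ-enumerated≈Φ k l (k ∸ l) 0 (ℕₚ.≤-trans (ℕₚ.≤-reflexive (ℕₚ.m∸n+n≡m l≤k)) (ℕₚ.n≤1+n k)) ⟩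
    Φ l (k ∸ l) 0 ∎
    where
    V = allVecs (k ∸ l) (entries k)
    weights-agree : ∀ rs → when (validFrom l rs) (pow q (size rs ∸ 2 ℕ.* (k ∸ l))) ≈ familyWeight l 0 rs
    weights-agree rs = begin
      when (validFrom l rs) (pow q (size rs ∸ 2 ℕ.* (k ∸ l)))
        ≈⟨ when-cong (validFrom l rs) (λ valid → reflexive (Eq.cong (pow q) (size∸2n≡excess valid))) ⟩
      when (validFrom l rs) (pow q (excess rs))
        ≡⟨ Eq.cong (λ x → when x (pow q (excess rs))) (Eq.sym (admissible-0 l rs)) ⟩
      familyWeight l 0 rs ∎
      where
      size∸2n≡excess : T (validFrom l rs) → size rs ∸ 2 ℕ.* (k ∸ l) ≡ excess rs
      size∸2n≡excess valid = Eq.trans (Eq.cong (_∸ 2 ℕ.* (k ∸ l)) (size-valid l rs valid))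
                                      (ℕₚ.m+n∸m≡n (2 ℕ.* (k ∸ l)) (excess rs))

theorem10 : ∀ {c ℓ : Level} (R : CommutativeRing c ℓ) (q : CommutativeRing.Carrier R)
              (k l : ℕ) → 1 ≤ l → l ≤ k →
              CommutativeRing._≈_ R (WithRing.d R q k l) (WithRing.rhs R q k l)
theorem10 R q k l 1≤l l≤k with ℕₚ.m≤n⇒∃[o]m+o≡n l≤k
... | n , Eq.refl = trans (d≈Φ R q 1≤l n)
                          (sym (trans (rhs≈Φ R q l≤k) (reflexive (Eq.cong (λ e → Φ R q l e 0) (ℕₚ.m+n∸m≡n l n)))))
  where open CommutativeRing R using (trans; sym; reflexive)
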